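{- For all integers $m,n\geq 1$, every trigraph whose underlying graph is an $m\times n$ wall has twin-width at most $4$.
   Context: The $m\times n$ grid has vertex set $\{(i,j):1\le i\le m,1\le j\le n\}$ with $(i,j),(i',j')$ adjacent iff $|i-i'|+|j-j'|=1$. The elementary $m\times n$ wall is obtained from the $m\times n$ grid by removing all edges between $(i,j)$ and $(i,j+1)$ where $i$ and $j$ have the same parity, and then removing vertices of degree $1$; an $m\times n$ wall is a graph isomorphic to a subdivision of the elementary $m\times n$ wall. A trigraph has vertex set and disjoint black and red edge sets, with underlying graph using all edges. Contracting distinct $u,v$ gives a new vertex $x$ with $xy$ black if $uy,vy$ both black, absent if neither is an edge, red otherwise; twin-width is the least $d$ such that some sequence of contractions down to one vertex keeps every trigraph's maximum red degree at most $d$. -}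

module Defs where

open import Data.Nat using (ℕ; zero; suc; _≤_; _≡ᵇ_)
open import Data.Bool using (Bool; true; false; not; _∧_; _∨_; _xor_; if_then_else_; T)
open import Data.Fin using (Fin; toℕ; punchIn; _≟_)
open import Data.List using (List; allFin; map)
open import Data.Nat.ListAction using (sum)
open import Data.Maybe using (Maybe; just; nothing)
open import Data.Product using (Σ; _×_; _,_)
open import Data.Sum using (_⊎_)
open import Data.Empty using (⊥)
open import Data.Unit using (⊤)
open import Relation.Nullary using (¬_; yes; no)
open import Relation.Binary.PropositionalEquality using (_≡_; _≢_)
open import Function.Bundles using (_↔_; _⇔_; Inverse)

record Graph : Set₁ where
  field
    V : Set
    E : V → V → Set
open Graph public

Iso : Graph → Graph → Set
Iso G H = Σ (V G ↔ V H) λ f →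
  ∀ x y → E G x y ⇔ E H (Inverse.to f x) (Inverse.to f y)

subdivide : (H : Graph) → V H → V H → Graph
subdivide H u v = record { V = Maybe (V H) ; E = E' }
  where
  E' : Maybe (V H) → Maybe (V H) → Set
  E' (just x) (just y) = E H x y × ¬ (x ≡ u × y ≡ v) × ¬ (x ≡ v × y ≡ u)
  E' nothing  (just y) = y ≡ u ⊎ y ≡ v
  E' (just x) nothing  = x ≡ u ⊎ x ≡ v
  E' nothing  nothing  = ⊥

data SubdivOf (G : Graph) : Graph → Set₁ where
  base : SubdivOf G G
  step : ∀ {H} → SubdivOf G H → (u v : V H) → E H u v →
         SubdivOf G (subdivide H u v)

-- Walls.  Coordinates i ∈ Fin m stand for row toℕ i + 1 (and likewise
-- columns); parity of (toℕ i + 1) and (toℕ j + 1) agree iff parity of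
-- toℕ i and toℕ j agree.

odd : ℕ → Bool
odd zero    = false
odd (suc n) = not (odd n)

samePar : ℕ → ℕ → Bool
samePar a b = not (odd a xor odd b)

gridAdjℕ : ℕ → ℕ → ℕ → ℕ → Bool
gridAdjℕ a b a' b' =
  ((a ≡ᵇ a') ∧ ((suc b ≡ᵇ b') ∨ (suc b' ≡ᵇ b))) ∨
  ((b ≡ᵇ b') ∧ ((suc a ≡ᵇ a') ∨ (suc a' ≡ᵇ a)))

removedℕ : ℕ → ℕ → ℕ → ℕ → Bool
removedℕ a b a' b' =
  (a ≡ᵇ a') ∧ (((suc b ≡ᵇ b') ∧ samePar a b) ∨ ((suc b' ≡ᵇ b) ∧ samePar a b'))

wallAdj : ∀ {m n} → Fin m × Fin n → Fin m × Fin n → Bool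
wallAdj (i , j) (i' , j') =
  gridAdjℕ (toℕ i) (toℕ j) (toℕ i') (toℕ j') ∧
  not (removedℕ (toℕ i) (toℕ j) (toℕ i') (toℕ j'))

wallDeg : ∀ {m n} → Fin m × Fin n → ℕ
wallDeg {m} {n} p =
  sum (map (λ i' → sum (map (λ j' → if wallAdj p (i' , j') then 1 else 0)
                             (allFin n)))
           (allFin m))

elementaryWall : ℕ → ℕ → Graph
elementaryWall m n = record
  { V = Σ (Fin m × Fin n) (λ p → T (not (wallDeg p ≡ᵇ 1)))
  ; E = λ { (p , _) (q , _) → T (wallAdj p q) }
  }

IsWall : ℕ → ℕ → Graph → Set₁
IsWall m n G = Σ Graph λ H → SubdivOf (elementaryWall m n) H × Iso H G

-- Trigraphs on vertex set Fin k, given by an edge colouring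
-- (none = non-edge); black and red edge sets are disjoint by construction.

data Colour : Set where
  none black red : Colour

IsTrigraph : ∀ {k} → (Fin k → Fin k → Colour) → Set
IsTrigraph col = (∀ x y → col x y ≡ col y x) × (∀ x → col x x ≡ none)

underlying : ∀ {k} → (Fin k → Fin k → Colour) → Graph
underlying {k} col = record { V = Fin k ; E = λ x y → col x y ≢ none }

merge : Colour → Colour → Colour
merge black black = black
merge none  none  = none
merge _     _     = red

-- The result has vertex
-- set Fin k, identified with Fin (suc k) ∖ {v} via punchIn v; the vertex
-- punched in at position u plays the role of the new vertex x.
contract : ∀ {k} → (Fin (suc k) → Fin (suc k) → Colour) →
           Fin (suc k) → Fin (suc k) → Fin k → Fin k → Colour
contract col u v a b with a ≟ b
... | yes _ = none
... | no _ with punchIn v a ≟ u | punchIn v b ≟ u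
...   | yes _ | _     = merge (col u (punchIn v b)) (col v (punchIn v b))
...   | no _  | yes _ = merge (col (punchIn v a) u) (col (punchIn v a) v)
...   | no _  | no _  = col (punchIn v a) (punchIn v b)

redInd : Colour → ℕ
redInd red = 1
redInd _   = 0

redDeg : ∀ {k} → (Fin k → Fin k → Colour) → Fin k → ℕ
redDeg {k} col x = sum (map (λ y → redInd (col x y)) (allFin k))

RedBounded : ℕ → ∀ {k} → (Fin k → Fin k → Colour) → Set
RedBounded d col = ∀ x → redDeg col x ≤ d

ContrSeq : ℕ → (k : ℕ) → (Fin (suc k) → Fin (suc k) → Colour) → Set
ContrSeq d zero    col = RedBounded d col
ContrSeq d (suc k) col =
  RedBounded d col ×
  Σ (Fin (suc (suc k))) λ u → Σ (Fin (suc (suc k))) λ v →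
    u ≢ v × ContrSeq d k (contract col u v)

TwwAtMost : ℕ → ∀ {k} → (Fin k → Fin k → Colour) → Set
TwwAtMost d {zero}  col = ⊤
TwwAtMost d {suc k} col = ContrSeq d k col

-- A trigraph is handled through an embedding (an injective, edge-preserving vertex map) of its
-- underlying graph into a host graph of maximum degree at most 4, which bounds its red degrees by 4.
-- If a map of hosts identifies two vertices x and y and is otherwise injective and edge-preserving,
-- contracting the trigraph vertices over x and y (when both exist) gives a trigraph embedded in the
-- new host. A chain of such identifications ending in an edgeless host therefore yields a
-- contraction sequence of red degree at most 4.
--
-- For the grid the hosts are quotients of the m × n grid. In the quotient by clampRows (front r j)
-- the rows ≤ r + 1 of the columns < j and the rows ≤ r of the other columns are merged, so every
-- class has at most four neighbouring classes: left, right, above, and one below or diagonally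
-- below. Identifying the classes of (r , j) and (r + 1 , j) moves this staircase one column on.
-- Once all rows are merged, the remaining path is merged column by column. The elementary wall
-- embeds into the grid, and the new vertex of a subdivided edge uv is absorbed by identifying it
-- with u, which keeps the maximum degree at most 4.

module Submission where

open import Defs
open import Data.Nat using (ℕ; zero; suc; pred; _≤_; _<_; z≤n; s≤s; s≤s⁻¹; _⊔_; _≡ᵇ_)
open import Data.Nat.Properties
  using (_≟_; _≤?_; _<?_; ≤-trans; ≤-refl; ≤-reflexive; <⇒≤; ≰⇒>; <⇒≤pred; n≤1+n; n<1+n; n≮n;
         1+n≢n; 1+n≰n; <-trans; ≤∧≢⇒<; m≤n⇒m≤1+n; m≤n⇒m⊔n≡n; m≥n⇒m⊔n≡m; ⊔-assoc; ⊔-identityʳ;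
         pred-mono-≤; ≡ᵇ⇒≡)
open import Data.Bool using (false; not; _∧_; _∨_; T)
open import Data.Bool.Properties using (T-∧; T-∨; T-≡; ∨-comm; ¬-not; T-irrelevant)
open import Data.Fin using (Fin; zero; suc; toℕ; punchIn) renaming (_≟_ to _≟ᶠ_)
open import Data.Fin.Properties using (any?; punchIn-injective; punchInᵢ≢i; toℕ-injective; toℕ<n)
open import Data.List using (List; []; _∷_; length; map; filter; allFin)
open import Data.List.Properties using (length-map; length-removeAt′)
open import Data.List.Relation.Unary.Any using (here; there; index; _─_)
import Data.List.Relation.Unary.All as All
open All using (All; []; _∷_)
import Data.List.Relation.Unary.All.Properties as All
open import Data.List.Relation.Unary.AllPairs using ([]; _∷_)
open import Data.List.Relation.Unary.Unique.Propositional using (Unique)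
open import Data.List.Relation.Unary.Unique.Propositional.Properties using (allFin⁺; filter⁺)
open import Data.List.Membership.Propositional using (_∈_)
open import Data.List.Relation.Binary.Subset.Propositional using (_⊆_)
open import Data.Nat.ListAction using (sum)
open import Data.Maybe using (Maybe; just; nothing; fromMaybe)
import Data.Maybe.Properties as Maybe
open import Data.Product using (∃₂; _×_; _,_; proj₁; proj₂)
import Data.Product.Properties as Product
open import Data.Sum using (_⊎_; inj₁; inj₂)
import Data.Sum as Sum
open import Data.Empty using (⊥; ⊥-elim)
open import Data.Unit using (tt)
open import Function using (_∘_; id)
open import Function.Bundles using (Inverse; Equivalence)
open import Function.Definitions using (Injective)
open import Relation.Nullary using (¬_; Dec; yes; no)
open import Relation.Unary using (Decidable)
open import Relation.Binary.Definitions using (DecidableEquality; Symmetric)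
open import Relation.Binary.PropositionalEquality
  using (_≡_; _≢_; refl; sym; trans; cong; cong₂; subst; subst₂; ≢-sym; module ≡-Reasoning)

-- Graphs of bounded degree

∈-─ : ∀ {A : Set} {x y : A} {ys} (x∈ys : x ∈ ys) → y ∈ ys → y ≢ x → y ∈ (ys ─ x∈ys)
∈-─ (here refl) (here refl) y≢x = ⊥-elim (y≢x refl)
∈-─ (here refl) (there y∈ys) _ = y∈ys
∈-─ (there x∈ys) (here refl) _ = here refl
∈-─ (there x∈ys) (there y∈ys) y≢x = there (∈-─ x∈ys y∈ys y≢x)

unique⊆⇒length≤ : ∀ {A : Set} {xs ys : List A} → Unique xs → xs ⊆ ys → length xs ≤ length ys
unique⊆⇒length≤ {xs = []} _ _ = z≤n
unique⊆⇒length≤ {xs = x ∷ xs} {ys} (x∉xs ∷ xs!) xs⊆ys = begin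
  suc (length xs)          ≤⟨ s≤s (unique⊆⇒length≤ xs! xs⊆ys─x) ⟩
  suc (length (ys ─ x∈ys)) ≡⟨ sym (length-removeAt′ ys (index x∈ys)) ⟩
  length ys                ∎
  where
  open Data.Nat.Properties.≤-Reasoning
  x∈ys : x ∈ ys
  x∈ys = xs⊆ys (here refl)
  xs⊆ys─x : xs ⊆ (ys ─ x∈ys)
  xs⊆ys─x z∈xs = ∈-─ x∈ys (xs⊆ys (there z∈xs)) (≢-sym (All.lookup x∉xs z∈xs))

map⁺-injectiveOn : ∀ {A B : Set} {P : A → Set} {f : A → B} {xs} →
                   (∀ {x y} → P x → P y → f x ≡ f y → x ≡ y) →
                   All P xs → Unique xs → Unique (map f xs)
map⁺-injectiveOn inj [] [] = []
map⁺-injectiveOn inj (px ∷ pxs) (x∉xs ∷ xs!) =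
  All.map⁺ (All.zipWith (λ (py , x≢y) fx≡fy → x≢y (inj px py fx≡fy)) (pxs , x∉xs))
  ∷ map⁺-injectiveOn inj pxs xs!

DegreeAtMost : ℕ → (G : Graph) → V G → Set
DegreeAtMost d G x = ∀ {ys} → Unique ys → All (E G x) ys → length ys ≤ d

MaxDegreeAtMost : ℕ → Graph → Set
MaxDegreeAtMost d G = ∀ x → DegreeAtMost d G x

degreeAtMost-⊆ : ∀ {d G x} (N : List (V G)) → (∀ {y} → E G x y → y ∈ N) →
                 length N ≤ d → DegreeAtMost d G x
degreeAtMost-⊆ N nbrs N≤d ys! adj =
  ≤-trans (unique⊆⇒length≤ ys! (λ y∈ys → nbrs (All.lookup adj y∈ys))) N≤d

degreeAtMost-map : ∀ {d G H x w} (τ : V G → V H) →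
                   (∀ {y} → E G x y → E H w (τ y)) →
                   (∀ {y y'} → E G x y → E G x y' → τ y ≡ τ y' → y ≡ y') →
                   DegreeAtMost d H w → DegreeAtMost d G x
degreeAtMost-map τ adj inj deg {ys} ys! xys =
  subst (_≤ _) (length-map τ ys) (deg (map⁺-injectiveOn inj xys ys!) (All.map⁺ (All.map adj xys)))

maxDegree-edgeless : ∀ {d G} → (∀ {x y} → ¬ E G x y) → MaxDegreeAtMost d G
maxDegree-edgeless no-edge x [] [] = z≤n
maxDegree-edgeless no-edge x _ (xy ∷ _) = ⊥-elim (no-edge xy)

record Embedding (G H : Graph) : Set where
  field
    to        : V G → V H
    injective : Injective _≡_ _≡_ to
    edge      : ∀ {x y} → E G x y → E H (to x) (to y)

_∘ᴱ_ : ∀ {F G H} → Embedding G H → Embedding F G → Embedding F H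
g ∘ᴱ f = record
  { to        = G.to ∘ F.to
  ; injective = F.injective ∘ G.injective
  ; edge      = G.edge ∘ F.edge
  }
  where module G = Embedding g; module F = Embedding f

maxDegree-embed : ∀ {d G H} → Embedding G H → MaxDegreeAtMost d H → MaxDegreeAtMost d G
maxDegree-embed {G = G} {H} e deg x =
  degreeAtMost-map {G = G} {H} to edge (λ _ _ → injective) (deg (to x))
  where open Embedding e

-- Contraction sequences

Loopless : ∀ {k} → (Fin k → Fin k → Colour) → Set
Loopless col = ∀ a → col a a ≡ none

Contractible : ℕ → Graph → Set
Contractible d G = ∀ {k} (col : Fin (suc k) → Fin (suc k) → Colour) →
                   Loopless col → Embedding (underlying col) G → ContrSeq d k col

isRed? : Decidable (_≡ red)
isRed? none  = no λ ()
isRed? black = no λ ()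
isRed? red   = yes refl

redCount : ∀ {A : Set} (f : A → Colour) xs →
           sum (map (redInd ∘ f) xs) ≡ length (filter (isRed? ∘ f) xs)
redCount f [] = refl
redCount f (x ∷ xs) with f x
... | none  = redCount f xs
... | black = redCount f xs
... | red   = cong suc (redCount f xs)

redBounded : ∀ {d k} (col : Fin k → Fin k → Colour) →
             MaxDegreeAtMost d (underlying col) → RedBounded d col
redBounded {k = k} col deg x =
  subst (_≤ _) (sym (redCount (col x) (allFin k)))
    (deg x (filter⁺ (isRed? ∘ col x) (allFin⁺ k))
           (All.map red≢none (All.all-filter (isRed? ∘ col x) (allFin k))))
  where
  red≢none : ∀ {c} → c ≡ red → c ≢ none
  red≢none refl ()

merge-≢none : ∀ p q → merge p q ≢ none → p ≢ none ⊎ q ≢ none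
merge-≢none none  none  ≢none = ⊥-elim (≢none refl)
merge-≢none none  black _     = inj₂ λ ()
merge-≢none none  red   _     = inj₂ λ ()
merge-≢none black _     _     = inj₁ λ ()
merge-≢none red   _     _     = inj₁ λ ()

data Represents {k} (u v : Fin (suc k)) (a : Fin k) : Fin (suc k) → Set where
  itself   : Represents u v a (punchIn v a)
  absorbed : punchIn v a ≡ u → Represents u v a v

contract-edge : ∀ {k} (col : Fin (suc k) → Fin (suc k) → Colour) u v {a b} →
                contract col u v a b ≢ none →
                a ≢ b × ∃₂ λ s t → Represents u v a s × Represents u v b t × col s t ≢ none
contract-edge col u v {a} {b} ≢none with a ≟ᶠ b
... | yes _ = ⊥-elim (≢none refl)
... | no a≢b with punchIn v a ≟ᶠ u | punchIn v b ≟ᶠ u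
...   | yes a↦u | _ with merge-≢none (col u (punchIn v b)) _ ≢none
...     | inj₁ ut = a≢b , u , _ , subst (Represents u v a) a↦u itself , itself , ut
...     | inj₂ vt = a≢b , v , _ , absorbed a↦u , itself , vt
contract-edge col u v {a} {b} ≢none | no a≢b | no _ | yes b↦u
  with merge-≢none (col (punchIn v a) u) _ ≢none
...     | inj₁ su = a≢b , _ , u , itself , subst (Represents u v b) b↦u itself , su
...     | inj₂ sv = a≢b , _ , v , itself , absorbed b↦u , sv
contract-edge col u v ≢none | no a≢b | no _ | no _ = a≢b , _ , _ , itself , itself , ≢none

contract-loopless : ∀ {k} (col : Fin (suc k) → Fin (suc k) → Colour) u v → Loopless (contract col u v)
contract-loopless col u v a with a ≟ᶠ a
... | yes _   = refl
... | no a≢a = ⊥-elim (a≢a refl)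

contrSeq-edgeless : ∀ {d k} (col : Fin (suc k) → Fin (suc k) → Colour) →
                    (∀ {a b} → ¬ E (underlying col) a b) → ContrSeq d k col
contrSeq-edgeless {k = zero} col no-edge = redBounded col (maxDegree-edgeless no-edge)
contrSeq-edgeless {k = suc k} col no-edge =
  redBounded col (maxDegree-edgeless no-edge) , zero , suc zero , (λ ()) ,
  contrSeq-edgeless (contract col zero (suc zero))
    λ {a} {b} ab → let (_ , _ , _ , _ , _ , st) = contract-edge col zero (suc zero) {a} {b} ab
                   in no-edge st

contractible-edgeless : ∀ {d G} → (∀ {x y} → ¬ E G x y) → Contractible d G
contractible-edgeless no-edge col _ e = contrSeq-edgeless col (no-edge ∘ Embedding.edge e)

contractible-embed : ∀ {d G H} → Embedding G H → Contractible d H → Contractible d G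
contractible-embed g H-contractible col loopless e = H-contractible col loopless (g ∘ᴱ e)

iso⇒embedding : ∀ {H k} {col : Fin k → Fin k → Colour} →
                Iso H (underlying col) → Embedding (underlying col) H
iso⇒embedding {H} {col = col} (f , adj) = record { to = from ; injective = injective ; edge = edge }
  where
  open Inverse f
  injective : Injective _≡_ _≡_ from
  injective {a} {b} eq = trans (sym (strictlyInverseˡ a)) (trans (cong to eq) (strictlyInverseˡ b))
  edge : ∀ {a b} → col a b ≢ none → E H (from a) (from b)
  edge {a} {b} ab = Equivalence.from (adj (from a) (from b))
    (subst₂ (λ a' b' → col a' b' ≢ none) (sym (strictlyInverseˡ a)) (sym (strictlyInverseˡ b)) ab)

record VertexIdentification (G G' : Graph) : Set where
  field
    x y          : V G
    x≢y          : x ≢ y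
    σ            : V G → V G'
    σ-identifies : σ x ≡ σ y
    σ-injective  : ∀ {p q} → p ≢ x → q ≢ x → σ p ≡ σ q → p ≡ q
    σ-edge       : ∀ {p q} → E G p q → σ p ≢ σ q → E G' (σ p) (σ q)

module _ {G G' : Graph} (_≟ᵥ_ : DecidableEquality (V G)) (ι : VertexIdentification G G') where
  open VertexIdentification ι

  private
    σ≡σx⇒≡y : ∀ {p} → p ≢ x → σ p ≡ σ x → p ≡ y
    σ≡σx⇒≡y p≢x σp≡σx = σ-injective p≢x (≢-sym x≢y) (trans σp≡σx σ-identifies)

  identify-embedding : ∀ {k} {col : Fin k → Fin k → Colour} → Loopless col →
                       (e : Embedding (underlying col) G) →
                       (∀ {a b} → Embedding.to e a ≡ x → Embedding.to e b ≡ y → ⊥) →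
                       Embedding (underlying col) G'
  identify-embedding {col = col} loopless e not-both = record
    { to = σ ∘ φ ; injective = inj ; edge = λ ab → σ-edge (edge ab) (≢none⇒≢ ab ∘ inj) }
    where
    open Embedding e renaming (to to φ; injective to φ-injective)
    inj : Injective _≡_ _≡_ (σ ∘ φ)
    inj {a} {b} σφ≡ with φ a ≟ᵥ x | φ b ≟ᵥ x
    ... | yes ax | yes bx = φ-injective (trans ax (sym bx))
    ... | yes ax | no bx  = ⊥-elim (not-both ax (σ≡σx⇒≡y bx (trans (sym σφ≡) (cong σ ax))))
    ... | no ax  | yes bx = ⊥-elim (not-both bx (σ≡σx⇒≡y ax (trans σφ≡ (cong σ bx))))
    ... | no ax  | no bx  = φ-injective (σ-injective ax bx σφ≡)
    ≢none⇒≢ : ∀ {a b} → col a b ≢ none → a ≢ b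
    ≢none⇒≢ {a} ab refl = ab (loopless a)

  contract-embedding : ∀ {k} {col : Fin (suc (suc k)) → Fin (suc (suc k)) → Colour}
                       (e : Embedding (underlying col) G) {a b} →
                       Embedding.to e a ≡ x → Embedding.to e b ≡ y →
                       Embedding (underlying (contract col b a)) G'
  contract-embedding {k} {col} e {a} {b} ax by = record
    { to = φ' ; injective = inj ; edge = edge' }
    where
    open Embedding e renaming (to to φ; injective to φ-injective)
    φ' : Fin (suc k) → V G'
    φ' = σ ∘ φ ∘ punchIn a
    φ-punchIn≢x : ∀ a' → φ (punchIn a a') ≢ x
    φ-punchIn≢x a' φa'≡x = punchInᵢ≢i a a' (φ-injective (trans φa'≡x (sym ax)))
    inj : Injective _≡_ _≡_ φ'
    inj {a₁} {a₂} =
      punchIn-injective a a₁ a₂ ∘ φ-injective ∘ σ-injective (φ-punchIn≢x a₁) (φ-punchIn≢x a₂)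
    represents : ∀ {a' s} → Represents b a a' s → σ (φ s) ≡ φ' a'
    represents itself = refl
    represents (absorbed a'↦b) = begin
      σ (φ a)  ≡⟨ cong σ ax ⟩
      σ x      ≡⟨ σ-identifies ⟩
      σ y      ≡⟨ cong σ (sym by) ⟩
      σ (φ b)  ≡⟨ cong (σ ∘ φ) (sym a'↦b) ⟩
      φ' _     ∎
      where open ≡-Reasoning
    edge' : ∀ {a₁ a₂} → contract col b a a₁ a₂ ≢ none → E G' (φ' a₁) (φ' a₂)
    edge' {a₁} {a₂} ≢none with contract-edge col b a ≢none
    ... | a₁≢a₂ , s , t , s~a₁ , t~a₂ , st =
      subst₂ (E G') (represents s~a₁) (represents t~a₂)
        (σ-edge (edge st) λ σs≡σt →
          a₁≢a₂ (inj (trans (sym (represents s~a₁)) (trans σs≡σt (represents t~a₂)))))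

  contractible-identify : ∀ {d} → MaxDegreeAtMost d G → Contractible d G' → Contractible d G
  contractible-identify deg G'-contractible {zero} col loopless e =
    redBounded col (maxDegree-embed e deg)
  contractible-identify deg G'-contractible {suc k} col loopless e
    with any? (λ a → Embedding.to e a ≟ᵥ x) | any? (λ b → Embedding.to e b ≟ᵥ y)
  ... | yes (a , ax) | yes (b , by) =
    redBounded col (maxDegree-embed e deg) , b , a , b≢a ,
    G'-contractible (contract col b a) (contract-loopless col b a) (contract-embedding e ax by)
    where
    b≢a : b ≢ a
    b≢a refl = x≢y (trans (sym ax) by)
  ... | yes _   | no no-y =
    G'-contractible col loopless (identify-embedding loopless e λ _ by → no-y (_ , by))
  ... | no no-x | _       =
    G'-contractible col loopless (identify-embedding loopless e λ ax _ → no-x (_ , ax))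

-- Subdivisions

module _ {H : Graph} {u v : V H} where
  private
    H' = subdivide H u v

  subdivide-symmetric : Symmetric (E H) → Symmetric (E H')
  subdivide-symmetric sym-H {just _}  {just _}  (xy , ¬uv , ¬vu) =
    sym-H xy , (λ (y≡u , x≡v) → ¬vu (x≡v , y≡u)) , (λ (y≡v , x≡u) → ¬uv (x≡u , y≡v))
  subdivide-symmetric sym-H {just _}  {nothing} xy = xy
  subdivide-symmetric sym-H {nothing} {just _}  xy = xy

  subdivide-maxDegree : ∀ {d} → DecidableEquality (V H) → Symmetric (E H) → E H u v → 2 ≤ d →
                        MaxDegreeAtMost d H → MaxDegreeAtMost d H'
  subdivide-maxDegree _ _ _ 2≤d _ nothing =
    degreeAtMost-⊆ {G = H'} (just u ∷ just v ∷ []) nbrs 2≤d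
    where
    nbrs : ∀ {y} → E H' nothing y → y ∈ just u ∷ just v ∷ []
    nbrs {just _} (inj₁ refl) = here refl
    nbrs {just _} (inj₂ refl) = there (here refl)
  subdivide-maxDegree {d} _≟ᵥ_ sym-H uv _ deg (just x) = by-cases (x ≟ᵥ u)
    where
    -- the subdivision vertex stands in for the other end w of the subdivided edge
    via : (w : V H) → (E H' (just x) nothing → E H x w × ¬ E H' (just x) (just w)) →
          DegreeAtMost d H' (just x)
    via w to-w = degreeAtMost-map {G = H'} {H} (fromMaybe w) adj inj (deg x)
      where
      adj : ∀ {p} → E H' (just x) p → E H x (fromMaybe w p)
      adj {nothing} xp = proj₁ (to-w xp)
      adj {just _}  (xy , _) = xy
      inj : ∀ {p q} → E H' (just x) p → E H' (just x) q → fromMaybe w p ≡ fromMaybe w q → p ≡ q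
      inj {nothing} {nothing} _  _  _    = refl
      inj {nothing} {just _}  xp xq refl = ⊥-elim (proj₂ (to-w xp) xq)
      inj {just _}  {nothing} xp xq refl = ⊥-elim (proj₂ (to-w xq) xp)
      inj {just _}  {just _}  _  _  eq   = cong just eq
    by-cases : Dec (x ≡ u) → DegreeAtMost d H' (just x)
    by-cases (yes refl) = via v λ _ → uv , λ (_ , ¬uv , _) → ¬uv (refl , refl)
    by-cases (no x≢u)   = via u λ where
      (inj₁ x≡u)  → ⊥-elim (x≢u x≡u)
      (inj₂ refl) → sym-H uv , λ (_ , _ , ¬vu) → ¬vu (refl , refl)

  subdivide-identification : Symmetric (E H) → E H u v → VertexIdentification H' H
  subdivide-identification sym-H uv = record
    { x = nothing ; y = just u ; x≢y = λ () ; σ = fromMaybe u ; σ-identifies = refl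
    ; σ-injective = inj ; σ-edge = edge }
    where
    inj : ∀ {p q} → p ≢ nothing → q ≢ nothing → fromMaybe u p ≡ fromMaybe u q → p ≡ q
    inj {nothing} p≢ _  _  = ⊥-elim (p≢ refl)
    inj {just _}  {nothing} _ q≢ _ = ⊥-elim (q≢ refl)
    inj {just _}  {just _}  _ _ eq = cong just eq
    edge : ∀ {p q} → E H' p q → fromMaybe u p ≢ fromMaybe u q →
           E H (fromMaybe u p) (fromMaybe u q)
    edge {just _}  {just _}  (pq , _) _ = pq
    edge {nothing} {just _}  (inj₁ refl) u≢u = ⊥-elim (u≢u refl)
    edge {nothing} {just _}  (inj₂ refl) _   = uv
    edge {just _}  {nothing} (inj₁ refl) u≢u = ⊥-elim (u≢u refl)
    edge {just _}  {nothing} (inj₂ refl) _   = sym-H uv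

-- The first three fields are what it takes to pass contractibility on to subdivisions.
record Reducible (d : ℕ) (H : Graph) : Set where
  field
    decEq        : DecidableEquality (V H)
    symmetric    : Symmetric (E H)
    maxDegree    : MaxDegreeAtMost d H
    contractible : Contractible d H

subdivide-reducible : ∀ {d H u v} → 2 ≤ d → Reducible d H → E H u v →
                      Reducible d (subdivide H u v)
subdivide-reducible {d} {H} {u} {v} 2≤d r uv = record
  { decEq        = decEq'
  ; symmetric    = subdivide-symmetric symmetric
  ; maxDegree    = maxDegree'
  ; contractible = contractible-identify decEq' (subdivide-identification symmetric uv)
                     maxDegree' contractible
  }
  where
  open Reducible r
  decEq' : DecidableEquality (Maybe (V H))
  decEq' = Maybe.≡-dec decEq
  maxDegree' : MaxDegreeAtMost d (subdivide H u v)
  maxDegree' = subdivide-maxDegree decEq symmetric uv 2≤d maxDegree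

subdivision-reducible : ∀ {d G H} → 2 ≤ d → Reducible d G → SubdivOf G H → Reducible d H
subdivision-reducible 2≤d r base = r
subdivision-reducible 2≤d r (step G⇝H u v uv) =
  subdivide-reducible 2≤d (subdivision-reducible 2≤d r G⇝H) uv

-- Quotients of the grid

descend : (P : ℕ → Set) → (∀ j → P (suc j) → P j) → ∀ n → P n → P 0
descend P back zero    P0 = P0
descend P back (suc n) Pn = descend P back n (back n Pn)

Cell : Set
Cell = ℕ × ℕ

_≟ᶜ_ : DecidableEquality Cell
_≟ᶜ_ = Product.≡-dec _≟_ _≟_

data GridAdj : Cell → Cell → Set where
  right : ∀ {a b} → GridAdj (a , b) (a , suc b)
  left  : ∀ {a b} → GridAdj (a , suc b) (a , b)
  up    : ∀ {a b} → GridAdj (a , b) (suc a , b)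
  down  : ∀ {a b} → GridAdj (suc a , b) (a , b)

gridAdj-irreflexive : ∀ {c c'} → GridAdj c c' → c ≢ c'
gridAdj-irreflexive right ()
gridAdj-irreflexive left  ()
gridAdj-irreflexive up    ()
gridAdj-irreflexive down  ()

redirect : Cell → Cell → Cell → Cell
redirect x y p with p ≟ᶜ x
... | yes _ = y
... | no _  = p

redirect-source : ∀ x y → redirect x y x ≡ y
redirect-source x y with x ≟ᶜ x
... | yes _   = refl
... | no x≢x = ⊥-elim (x≢x refl)

redirect-other : ∀ {x y p} → p ≢ x → redirect x y p ≡ p
redirect-other {x} {y} {p} p≢x with p ≟ᶜ x
... | yes p≡x = ⊥-elim (p≢x p≡x)
... | no _    = refl

⊔-both-≤ : ∀ {a a' t} → a ≤ t → a' ≤ t → a ⊔ t ≡ a' ⊔ t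
⊔-both-≤ a≤t a'≤t = trans (m≤n⇒m⊔n≡n a≤t) (sym (m≤n⇒m⊔n≡n a'≤t))

clampRows : (ℕ → ℕ) → Cell → Cell
clampRows h (a , b) = a ⊔ h b , b

Staircase : (ℕ → ℕ) → Set
Staircase h = ∀ b → h (suc b) ≤ h b × h b ≤ suc (h (suc b))

-- A class on the front (a ≤ h b) has absorbed the cells below it, so its lower neighbour is the
-- class diagonally below it in the next column.
lower : (ℕ → ℕ) → Cell → Cell
lower h (a , b) with a ≤? h b
... | yes _ = pred a , suc b
... | no _  = pred a , b

lower-≤ : ∀ h {a b} → a ≤ h b → lower h (a , b) ≡ (pred a , suc b)
lower-≤ h {a} {b} a≤hb with a ≤? h b
... | yes _   = refl
... | no a≰hb = ⊥-elim (a≰hb a≤hb)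

lower-≰ : ∀ h {a b} → ¬ a ≤ h b → lower h (a , b) ≡ (pred a , b)
lower-≰ h {a} {b} a≰hb with a ≤? h b
... | yes a≤hb = ⊥-elim (a≰hb a≤hb)
... | no _     = refl

clampRows-neighbours : (ℕ → ℕ) → Cell → List Cell
clampRows-neighbours h (a , b) =
  map (clampRows h) ((a , suc b) ∷ (a , pred b) ∷ (suc a , b) ∷ lower h (a , b) ∷ [])

clampRows-adj : ∀ {h} → Staircase h → ∀ {c c'} → GridAdj c c' → clampRows h c ≢ clampRows h c' →
                clampRows h c' ∈ clampRows-neighbours h (clampRows h c)
clampRows-adj {h} st (right {a} {b}) _ with h b ≤? a
... | yes hb≤a = here (cong (λ t → t ⊔ h (suc b) , suc b) (sym (m≥n⇒m⊔n≡m hb≤a)))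
... | no hb≰a  = there (there (there (here (begin
  (a ⊔ h (suc b) , suc b)
    ≡⟨ cong (_, suc b) (⊔-both-≤ a≤h[1+b] (pred-mono-≤ (proj₂ (st b)))) ⟩
  clampRows h (pred (h b) , suc b)
    ≡⟨ cong (clampRows h) (sym (lower-≤ h ≤-refl)) ⟩
  clampRows h (lower h (h b , b))
    ≡⟨ cong (λ t → clampRows h (lower h (t , b))) (sym (m≤n⇒m⊔n≡n (<⇒≤ a<hb))) ⟩
  clampRows h (lower h (a ⊔ h b , b))  ∎))))
  where
  open ≡-Reasoning
  a<hb = ≰⇒> hb≰a
  a≤h[1+b] = s≤s⁻¹ (≤-trans a<hb (proj₂ (st b)))
clampRows-adj {h} st (left {a} {b}) _ = there (here (cong (_, b) (sym (begin
  a ⊔ h (suc b) ⊔ h b    ≡⟨ ⊔-assoc a _ _ ⟩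
  a ⊔ (h (suc b) ⊔ h b)  ≡⟨ cong (a ⊔_) (m≤n⇒m⊔n≡n (proj₁ (st b))) ⟩
  a ⊔ h b                ∎))))
  where open ≡-Reasoning
clampRows-adj {h} st (up {a} {b}) ≢ with h b ≤? a
... | yes hb≤a = there (there (here (cong (λ t → suc t ⊔ h b , b) (sym (m≥n⇒m⊔n≡m hb≤a)))))
... | no hb≰a  = ⊥-elim (≢ (cong (_, b) (⊔-both-≤ (<⇒≤ a<hb) a<hb)))
  where a<hb = ≰⇒> hb≰a
clampRows-adj {h} st (down {a} {b}) ≢ with h b ≤? a
... | yes hb≤a = there (there (there (here (begin
  clampRows h (a , b)
    ≡⟨ cong (clampRows h) (sym (lower-≰ h λ 1+a≤hb → 1+n≰n (≤-trans 1+a≤hb hb≤a))) ⟩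
  clampRows h (lower h (suc a , b))
    ≡⟨ cong (λ t → clampRows h (lower h (t , b))) (sym (m≥n⇒m⊔n≡m (m≤n⇒m≤1+n hb≤a))) ⟩
  clampRows h (lower h (suc a ⊔ h b , b))  ∎))))
  where open ≡-Reasoning
... | no hb≰a  = ⊥-elim (≢ (cong (_, b) (⊔-both-≤ a<hb (<⇒≤ a<hb))))
  where a<hb = ≰⇒> hb≰a

clampRows-raise : ∀ {h h'} j → h' j ≡ suc (h j) → (∀ {b} → b ≢ j → h' b ≡ h b) →
                  ∀ c → clampRows h' c ≡ redirect (h j , j) (suc (h j) , j) (clampRows h c)
clampRows-raise {h} {h'} j h'j≡ h'b≡ (a , b) with b ≟ j
... | no b≢j = begin
  (a ⊔ h' b , b)              ≡⟨ cong (λ t → a ⊔ t , b) (h'b≡ b≢j) ⟩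
  (a ⊔ h b , b)               ≡⟨ sym (redirect-other (b≢j ∘ cong proj₂)) ⟩
  redirect _ _ (a ⊔ h b , b)  ∎
  where open ≡-Reasoning
... | yes refl with a ≤? h b
...   | yes a≤hb = begin
  (a ⊔ h' b , b)                  ≡⟨ cong (_, b) (trans (m≤n⇒m⊔n≡n a≤h'b) h'j≡) ⟩
  (suc (h b) , b)                 ≡⟨ sym (redirect-source _ _) ⟩
  redirect (h b , b) _ (h b , b)  ≡⟨ cong (λ t → redirect _ _ (t , b)) (sym (m≤n⇒m⊔n≡n a≤hb)) ⟩
  redirect _ _ (a ⊔ h b , b)      ∎
  where
  open ≡-Reasoning
  a≤h'b = ≤-trans a≤hb (subst (h b ≤_) (sym h'j≡) (n≤1+n _))
...   | no a≰hb = begin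
  (a ⊔ h' b , b)              ≡⟨ cong (_, b) (trans (cong (a ⊔_) h'j≡) (m≥n⇒m⊔n≡m hb<a)) ⟩
  (a , b)                     ≡⟨ sym (redirect-other (a≰hb ∘ ≤-reflexive ∘ cong proj₁)) ⟩
  redirect _ _ (a , b)        ≡⟨ cong (λ t → redirect _ _ (t , b)) (sym (m≥n⇒m⊔n≡m (<⇒≤ hb<a))) ⟩
  redirect _ _ (a ⊔ h b , b)  ∎
  where
  open ≡-Reasoning
  hb<a = ≰⇒> a≰hb

front : ℕ → ℕ → ℕ → ℕ
front r j b with b <? j
... | yes _ = suc r
... | no _  = r

front-< : ∀ {r j b} → b < j → front r j b ≡ suc r
front-< {r} {j} {b} b<j with b <? j
... | yes _   = refl
... | no b≮j = ⊥-elim (b≮j b<j)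

front-≮ : ∀ {r j b} → ¬ b < j → front r j b ≡ r
front-≮ {r} {j} {b} b≮j with b <? j
... | yes b<j = ⊥-elim (b≮j b<j)
... | no _    = refl

front-staircase : ∀ r j → Staircase (front r j)
front-staircase r j b with b <? j | suc b <? j
... | yes _   | yes _    = ≤-refl , n≤1+n _
... | yes _   | no _     = n≤1+n _ , ≤-refl
... | no b≮j  | yes b<j  = ⊥-elim (b≮j (<-trans (n<1+n b) b<j))
... | no _    | no _     = ≤-refl , n≤1+n _

front-advance : ∀ r j → front r (suc j) j ≡ suc (front r j j)
front-advance r j = trans (front-< (n<1+n j)) (cong suc (sym (front-≮ (n≮n j))))

front-elsewhere : ∀ r j {b} → b ≢ j → front r (suc j) b ≡ front r j b
front-elsewhere r j {b} b≢j with b <? j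
... | yes b<j = front-< (<-trans b<j (n<1+n j))
... | no b≮j  = front-≮ (λ b<1+j → b≮j (≤∧≢⇒< (s≤s⁻¹ b<1+j) b≢j))

module Grid (m n : ℕ) where

  InGrid : Cell → Set
  InGrid (a , b) = a < m × b < n

  data QuotientEdge (q : Cell → Cell) : Cell → Cell → Set where
    image : ∀ {c c'} → InGrid c → InGrid c' → GridAdj c c' → q c ≢ q c' → QuotientEdge q (q c) (q c')

  GridQuotient : (Cell → Cell) → Graph
  GridQuotient q = record { V = Cell ; E = QuotientEdge q }

  gridQuotient-maxDegree : ∀ {d} q (N : Cell → List Cell) → (∀ p → length (N p) ≤ d) →
                           (∀ {c c'} → GridAdj c c' → q c ≢ q c' → q c' ∈ N (q c)) →
                           MaxDegreeAtMost d (GridQuotient q)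
  gridQuotient-maxDegree q N N≤d nbrs p = degreeAtMost-⊆ {G = GridQuotient q} (N p) in-N (N≤d p)
    where
    in-N : ∀ {p p'} → QuotientEdge q p p' → p' ∈ N p
    in-N (image _ _ adj qc≢qc') = nbrs adj qc≢qc'

  gridQuotient-identification : ∀ {q q' x y} → x ≢ y → (∀ c → q' c ≡ redirect x y (q c)) →
                                VertexIdentification (GridQuotient q) (GridQuotient q')
  gridQuotient-identification {q} {q'} {x} {y} x≢y q'≗ = record
    { x            = x
    ; y            = y
    ; x≢y          = x≢y
    ; σ            = redirect x y
    ; σ-identifies = trans (redirect-source x y) (sym (redirect-other (≢-sym x≢y)))
    ; σ-injective  = λ p≢x q≢x eq → trans (sym (redirect-other p≢x)) (trans eq (redirect-other q≢x))
    ; σ-edge       = edge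
    }
    where
    edge : ∀ {p p'} → QuotientEdge q p p' → redirect x y p ≢ redirect x y p' →
           QuotientEdge q' (redirect x y p) (redirect x y p')
    edge (image {c} {c'} c∈ c'∈ adj _) σ≢ =
      subst₂ (QuotientEdge q') (q'≗ c) (q'≗ c')
        (image c∈ c'∈ adj λ eq → σ≢ (trans (sym (q'≗ c)) (trans eq (q'≗ c'))))

  gridQuotient-embedding : ∀ {q q'} → (∀ {c} → InGrid c → q c ≡ q' c) →
                           Embedding (GridQuotient q) (GridQuotient q')
  gridQuotient-embedding {q} {q'} q≗q' = record { to = id ; injective = id ; edge = edge }
    where
    edge : ∀ {p p'} → QuotientEdge q p p' → QuotientEdge q' p p'
    edge (image c∈ c'∈ adj qc≢qc') =
      subst₂ (QuotientEdge q') (sym (q≗q' c∈)) (sym (q≗q' c'∈))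
        (image c∈ c'∈ adj λ eq → qc≢qc' (trans (q≗q' c∈) (trans eq (sym (q≗q' c'∈)))))

  clampRows-maxDegree : ∀ {h} → Staircase h → MaxDegreeAtMost 4 (GridQuotient (clampRows h))
  clampRows-maxDegree {h} st =
    gridQuotient-maxDegree (clampRows h) (clampRows-neighbours h) (λ _ → ≤-refl) (clampRows-adj st)

  row-step : ∀ r j → Contractible 4 (GridQuotient (clampRows (front r (suc j)))) →
             Contractible 4 (GridQuotient (clampRows (front r j)))
  row-step r j = contractible-identify _≟ᶜ_
    (gridQuotient-identification (1+n≢n ∘ sym ∘ cong proj₁)
      (clampRows-raise j (front-advance r j) (front-elsewhere r j)))
    (clampRows-maxDegree (front-staircase r j))

  next-row : ∀ {r c} → InGrid c → clampRows (front r n) c ≡ clampRows (front (suc r) 0) c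
  next-row {r} {a , b} (_ , b<n) = cong (λ t → a ⊔ t , b) (front-< b<n)

  clampColumns : ℕ → Cell → Cell
  clampColumns c (a , b) = pred m , b ⊔ c

  columnNeighbours : Cell → List Cell
  columnNeighbours (a , b) = (a , suc b) ∷ (a , pred b) ∷ []

  clampColumns-adj : ∀ {k c c'} → GridAdj c c' → clampColumns k c ≢ clampColumns k c' →
                     clampColumns k c' ∈ columnNeighbours (clampColumns k c)
  clampColumns-adj {k} (right {b = b}) ≢ with k ≤? b
  ... | yes k≤b = here (cong (pred m ,_) (begin
    suc b ⊔ k    ≡⟨ m≥n⇒m⊔n≡m (m≤n⇒m≤1+n k≤b) ⟩
    suc b        ≡⟨ cong suc (sym (m≥n⇒m⊔n≡m k≤b)) ⟩
    suc (b ⊔ k)  ∎))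
    where open ≡-Reasoning
  ... | no k≰b  = ⊥-elim (≢ (cong (pred m ,_) (⊔-both-≤ (<⇒≤ b<k) b<k)))
    where b<k = ≰⇒> k≰b
  clampColumns-adj {k} (left {b = b}) ≢ with k ≤? b
  ... | yes k≤b = there (here (cong (pred m ,_) (begin
    b ⊔ k             ≡⟨ m≥n⇒m⊔n≡m k≤b ⟩
    b                 ≡⟨ cong pred (sym (m≥n⇒m⊔n≡m (m≤n⇒m≤1+n k≤b))) ⟩
    pred (suc b ⊔ k)  ∎)))
    where open ≡-Reasoning
  ... | no k≰b  = ⊥-elim (≢ (cong (pred m ,_) (⊔-both-≤ b<k (<⇒≤ b<k))))
    where b<k = ≰⇒> k≰b
  clampColumns-adj up   ≢ = ⊥-elim (≢ refl)
  clampColumns-adj down ≢ = ⊥-elim (≢ refl)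

  clampColumns-shift : ∀ k p →
                       clampColumns (suc k) p ≡ redirect (pred m , k) (pred m , suc k) (clampColumns k p)
  clampColumns-shift k (a , b) with b ≤? k
  ... | yes b≤k = begin
    (pred m , b ⊔ suc k)           ≡⟨ cong (pred m ,_) (m≤n⇒m⊔n≡n (m≤n⇒m≤1+n b≤k)) ⟩
    (pred m , suc k)               ≡⟨ sym (redirect-source _ _) ⟩
    redirect _ _ (pred m , k)      ≡⟨ cong (λ t → redirect _ _ (pred m , t)) (sym (m≤n⇒m⊔n≡n b≤k)) ⟩
    redirect _ _ (pred m , b ⊔ k)  ∎
    where open ≡-Reasoning
  ... | no b≰k = begin
    (pred m , b ⊔ suc k)           ≡⟨ cong (pred m ,_) (m≥n⇒m⊔n≡m k<b) ⟩
    (pred m , b)                   ≡⟨ sym (redirect-other (b≰k ∘ ≤-reflexive ∘ cong proj₂)) ⟩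
    redirect _ _ (pred m , b)      ≡⟨ cong (λ t → redirect _ _ (pred m , t)) (sym (m≥n⇒m⊔n≡m (<⇒≤ k<b))) ⟩
    redirect _ _ (pred m , b ⊔ k)  ∎
    where
    open ≡-Reasoning
    k<b = ≰⇒> b≰k

  column-step : ∀ k → Contractible 4 (GridQuotient (clampColumns (suc k))) →
                Contractible 4 (GridQuotient (clampColumns k))
  column-step k = contractible-identify _≟ᶜ_
    (gridQuotient-identification (1+n≢n ∘ sym ∘ cong proj₂) (clampColumns-shift k))
    (gridQuotient-maxDegree (clampColumns k) columnNeighbours (λ _ → s≤s (s≤s z≤n)) clampColumns-adj)

  columns-collapsed : ∀ {p p'} → ¬ QuotientEdge (clampColumns (pred n)) p p'
  columns-collapsed (image {_ , b} {_ , b'} (_ , b<n) (_ , b'<n) _ ≢) =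
    ≢ (cong (pred m ,_) (⊔-both-≤ (<⇒≤pred b<n) (<⇒≤pred b'<n)))

  rows-collapsed : ∀ {c} → InGrid c → clampRows (front (pred m) 0) c ≡ clampColumns 0 c
  rows-collapsed {a , b} (a<m , _) =
    cong₂ _,_ (m≤n⇒m⊔n≡n (<⇒≤pred a<m)) (sym (⊔-identityʳ b))

  grid-contractible : Contractible 4 (GridQuotient (clampRows (front 0 0)))
  grid-contractible =
    descend (λ r → Contractible 4 (GridQuotient (clampRows (front r 0)))) row
      (pred m) (contractible-embed (gridQuotient-embedding rows-collapsed) columns)
    where
    columns : Contractible 4 (GridQuotient (clampColumns 0))
    columns = descend (λ k → Contractible 4 (GridQuotient (clampColumns k))) column-step
                (pred n) (contractible-edgeless columns-collapsed)
    row : ∀ r → Contractible 4 (GridQuotient (clampRows (front (suc r) 0))) →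
          Contractible 4 (GridQuotient (clampRows (front r 0)))
    row r = descend (λ j → Contractible 4 (GridQuotient (clampRows (front r j)))) (row-step r) n
            ∘ contractible-embed (gridQuotient-embedding next-row)

-- Walls

gridAdj-sound : ∀ a b a' b' → T (gridAdjℕ a b a' b') → GridAdj (a , b) (a' , b')
gridAdj-sound a b a' b' adj with Equivalence.to T-∨ adj
... | inj₁ horizontal = along-row (Equivalence.to T-∧ horizontal)
  where
  along-row : T (a ≡ᵇ a') × T ((suc b ≡ᵇ b') ∨ (suc b' ≡ᵇ b)) → GridAdj (a , b) (a' , b')
  along-row (a≡a' , bb')
    with ≡ᵇ⇒≡ a a' a≡a' | Sum.map (≡ᵇ⇒≡ (suc b) b') (≡ᵇ⇒≡ (suc b') b) (Equivalence.to T-∨ bb')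
  ... | refl | inj₁ refl = right
  ... | refl | inj₂ refl = left
... | inj₂ vertical = along-column (Equivalence.to T-∧ vertical)
  where
  along-column : T (b ≡ᵇ b') × T ((suc a ≡ᵇ a') ∨ (suc a' ≡ᵇ a)) → GridAdj (a , b) (a' , b')
  along-column (b≡b' , aa')
    with ≡ᵇ⇒≡ b b' b≡b' | Sum.map (≡ᵇ⇒≡ (suc a) a') (≡ᵇ⇒≡ (suc a') a) (Equivalence.to T-∨ aa')
  ... | refl | inj₁ refl = up
  ... | refl | inj₂ refl = down

≡ᵇ-comm : ∀ x y → (x ≡ᵇ y) ≡ (y ≡ᵇ x)
≡ᵇ-comm zero    zero    = refl
≡ᵇ-comm zero    (suc y) = refl
≡ᵇ-comm (suc x) zero    = refl
≡ᵇ-comm (suc x) (suc y) = ≡ᵇ-comm x y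

≢⇒≡ᵇ-false : ∀ {x y} → x ≢ y → (x ≡ᵇ y) ≡ false
≢⇒≡ᵇ-false {x} {y} x≢y = ¬-not (x≢y ∘ ≡ᵇ⇒≡ x y ∘ Equivalence.from T-≡)

gridAdjℕ-comm : ∀ a b a' b' → gridAdjℕ a b a' b' ≡ gridAdjℕ a' b' a b
gridAdjℕ-comm a b a' b' =
  cong₂ _∨_ (cong₂ _∧_ (≡ᵇ-comm a a') (∨-comm (suc b ≡ᵇ b') _))
            (cong₂ _∧_ (≡ᵇ-comm b b') (∨-comm (suc a ≡ᵇ a') _))

removedℕ-comm : ∀ a b a' b' → removedℕ a b a' b' ≡ removedℕ a' b' a b
removedℕ-comm a b a' b' with a ≟ a'
... | yes refl = cong ((a ≡ᵇ a) ∧_) (∨-comm ((suc b ≡ᵇ b') ∧ samePar a b) _)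
... | no a≢a' rewrite ≢⇒≡ᵇ-false a≢a' | ≢⇒≡ᵇ-false (≢-sym a≢a') = refl

elementaryWall-symmetric : ∀ {m n} → Symmetric (E (elementaryWall m n))
elementaryWall-symmetric {x = (i , j) , _} {y = (i' , j') , _} =
  subst T (cong₂ _∧_ (gridAdjℕ-comm (toℕ i) (toℕ j) (toℕ i') (toℕ j'))
                     (cong not (removedℕ-comm (toℕ i) (toℕ j) (toℕ i') (toℕ j'))))

module _ (m n : ℕ) where
  open Grid m n

  wallCell : V (elementaryWall m n) → Cell
  wallCell ((i , j) , _) = toℕ i , toℕ j

  elementaryWall-embedding : Embedding (elementaryWall m n) (GridQuotient (clampRows (front 0 0)))
  elementaryWall-embedding = record
    { to = wallCell ; injective = injective ; edge = λ {x} {y} → edge {x} {y} }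
    where
    injective : Injective _≡_ _≡_ wallCell
    injective {(i , j) , t} {(i' , j') , t'} eq
      with toℕ-injective (cong proj₁ eq) | toℕ-injective (cong proj₂ eq)
    ... | refl | refl = cong ((i , j) ,_) (T-irrelevant t t')
    unclamped : ∀ c → clampRows (front 0 0) c ≡ c
    unclamped (a , b) = cong (_, b) (⊔-identityʳ a)
    edge : ∀ {x y} → E (elementaryWall m n) x y →
           QuotientEdge (clampRows (front 0 0)) (wallCell x) (wallCell y)
    edge {(i , j) , _} {(i' , j') , _} xy =
      subst₂ (QuotientEdge _) (unclamped _) (unclamped _)
        (image (toℕ<n i , toℕ<n j) (toℕ<n i' , toℕ<n j') adj
          λ eq → gridAdj-irreflexive adj (trans (sym (unclamped _)) (trans eq (unclamped _))))
      where adj = gridAdj-sound _ _ _ _ (proj₁ (Equivalence.to T-∧ xy))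

  elementaryWall-reducible : Reducible 4 (elementaryWall m n)
  elementaryWall-reducible = record
    { decEq        = Product.≡-dec (Product.≡-dec _≟ᶠ_ _≟ᶠ_) λ t t' → yes (T-irrelevant t t')
    ; symmetric    = λ {x} {y} → elementaryWall-symmetric {x = x} {y}
    ; maxDegree    = maxDegree-embed elementaryWall-embedding (clampRows-maxDegree (front-staircase 0 0))
    ; contractible = contractible-embed elementaryWall-embedding grid-contractible
    }

proposition7p4 : (m n : ℕ) → 1 ≤ m → 1 ≤ n →
    (k : ℕ) (col : Fin k → Fin k → Colour) →
    IsTrigraph col → IsWall m n (underlying col) → TwwAtMost 4 col
proposition7p4 m n _ _ zero    col _              _                  = tt
proposition7p4 m n _ _ (suc k) col (_ , loopless) (H , wall⇝H , H≅col) =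
  Reducible.contractible H-reducible col loopless (iso⇒embedding H≅col)
  where
  H-reducible : Reducible 4 H
  H-reducible = subdivision-reducible (s≤s (s≤s z≤n)) (elementaryWall-reducible m n) wall⇝H
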